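{- There exists a set $A \subseteq \mathbb{Z}$ with $r_A(n) = 1$ for every integer $n$ such that, for all $x \geq 1$, \[ \frac{2\log x}{\log 5} + 2\left(1 - \frac{\log 3}{\log 5}\right) \leq A(-x,x) \leq \frac{2\log x}{\log 3} + 2. \]
   Context: For a set $A$ of integers, $r_A(n)$ denotes the number of pairs $(a,a') \in A \times A$ with $a \leq a'$ and $a + a' = n$. $A(-x,x)$ denotes the number of elements $a \in A$ with $-x \leq a \leq x$. -}

module Defs where

open import Data.Bool using (Bool; true; false; T)
open import Data.Nat as ℕ using (ℕ; zero; suc)
open import Data.Integer as ℤ using (ℤ; +_; -[1+_])
open import Data.Product using (Σ; _×_)
open import Relation.Binary.PropositionalEquality using (_≡_)

IntSet : Set
IntSet = ℤ → Bool

_∈_ : ℤ → IntSet → Set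
a ∈ A = T (A a)

-- "r_A(n) = 1": there is exactly one pair (a , a') ∈ A × A with a ≤ a' and
-- a + a' = n.  A pair is determined by its first component a (a' = n - a),
-- so this says: exactly one a with a ∈ A, n - a ∈ A, a ≤ n - a.
RepPair : IntSet → ℤ → ℤ → Set
RepPair A n a = (a ∈ A) × ((n ℤ.- a) ∈ A) × (a ℤ.≤ n ℤ.- a)

RepOne : IntSet → ℤ → Set
RepOne A n = Σ ℤ λ a → RepPair A n a × (∀ b → RepPair A n b → b ≡ a)

[_] : Bool → ℕ
[ true ] = 1
[ false ] = 0

-- countSym A N = A(-N,N) = #{ a ∈ A : -N ≤ a ≤ N }
countSym : IntSet → ℕ → ℕ
countSym A zero = [ A (+ 0) ]
countSym A (suc N) = countSym A N ℕ.+ [ A (+ suc N) ] ℕ.+ [ A -[1+ N ] ]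

{-# OPTIONS --safe #-}
-- A is the union of finite Sidon sets A₀ ⊂ A₁ ⊂ ⋯ with Aₖ ⊆ [-dₖ, dₖ].  At step k let n be the
-- k-th integer in the order 0, -1, 1, -2, 2, …, unless that is already a sum of two elements of
-- Aₖ, in which case n = 2dₖ + 1, which cannot be one.  Adding u = 3dₖ + 1 + max(n, 0) and
-- v = -(3dₖ + 1 + max(-n, 0)), so that u + v = n, keeps the set Sidon: sums involving u but not v
-- exceed 2dₖ, sums involving v but not u are below -2dₖ, and u + v = n is not an old sum.  Hence
-- every integer eventually is a sum, and then in exactly one way.  As |n| ≤ 2dₖ + 1, the radius
-- satisfies 3dₖ < dₖ₊₁ ≤ 5dₖ + 2, while |Aₖ| = 2k + 5.  For dₖ ≤ N < dₖ₊₁ the interval [-N, N]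
-- contains Aₖ and, once N > 3dₖ, one of u and v; this gives the bounds with bases 5 and 3.
module Submission where

open import Defs hiding (_∈_)
open import Data.Bool using (true; false; T; _∨_)
open import Data.Empty using (⊥-elim)
open import Data.Integer as ℤ using (ℤ; +_; -[1+_]; ∣_∣)
import Data.Integer.Properties as ℤ
import Data.Integer.Tactic.RingSolver as ℤ-Solver
open import Data.List using (List; []; _∷_; length; filter)
open import Data.List.Properties using (filter-all)
open import Data.List.Relation.Unary.All as All using (All; []; _∷_; all?)
open import Data.List.Relation.Unary.Any as Any using (Any; here; there; any?)
open import Data.List.Membership.DecPropositional ℤ._≟_ using (_∈_; _∈?_; find; lose)
open import Data.List.Relation.Unary.Unique.DecPropositional ℤ._≟_ using (Unique; unique?; []; _∷_)
import Data.Nat as ℕ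
import Data.Nat.Properties as ℕ
open import Data.Product using (Σ; ∃; _×_; _,_; proj₁; proj₂)
open import Data.Sum using (_⊎_; inj₁; inj₂)
open import Function using (_∘_; id; _⇔_; mk⇔; Equivalence)
open import Relation.Binary.Definitions using (tri<; tri≈; tri>)
open import Relation.Binary.PropositionalEquality hiding ([_])
open import Relation.Nullary using (Dec; does; yes; no; ¬_)
open import Relation.Nullary.Decidable
  using (map′; _×-dec_; _⊎-dec_; _→-dec_; from-yes; dec-true; dec-false; does-⇔)

-- Sidon sets

module SidonSets where

  open import Data.Integer using (_+_; _-_; -_; _*_; _≤_; _<_; _≤?_; _≟_; +≤+; -≤-; -≤+)
  open import Data.Integer.Properties
  open import Data.Integer.Tactic.RingSolver using (solve-∀)
  open import Algebra.Bundles using (AbelianGroup)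
  open import Algebra.Properties.Group (AbelianGroup.group +-0-abelianGroup)
    using (∙-cancelˡ; ∙-cancelʳ)

  SamePair : ℤ → ℤ → ℤ → ℤ → Set
  SamePair a a' b b' = (a ≡ b × a' ≡ b') ⊎ (a ≡ b' × a' ≡ b)

  samePair? : ∀ a a' b b' → Dec (SamePair a a' b b')
  samePair? a a' b b' = (a ≟ b ×-dec a' ≟ b') ⊎-dec (a ≟ b' ×-dec a' ≟ b)

  samePair-swap : ∀ {a a' b b'} → SamePair a a' b b' → SamePair a' a b b'
  samePair-swap (inj₁ (a≡b , a'≡b')) = inj₂ (a'≡b' , a≡b)
  samePair-swap (inj₂ (a≡b' , a'≡b)) = inj₁ (a'≡b , a≡b')

  Sidon : (ℤ → Set) → Set
  Sidon P = ∀ {a a' b b'} → P a → P a' → P b → P b' → a + a' ≡ b + b' → SamePair a a' b b'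

  sidon? : ∀ L → Dec (Sidon (_∈ L))
  sidon? L = map′
    (λ h a∈ a'∈ b∈ b'∈ → All.lookup (All.lookup (All.lookup (All.lookup h a∈) a'∈) b∈) b'∈)
    (λ sidon → All.tabulate λ a∈ → All.tabulate λ a'∈ → All.tabulate λ b∈ → All.tabulate λ b'∈ →
      sidon a∈ a'∈ b∈ b'∈)
    (all? (λ a → all? (λ a' → all? (λ b → all? (λ b' →
      (a + a' ≟ b + b') →-dec samePair? a a' b b') L) L) L) L)

  sidon-∷ : ∀ {w M} → Sidon (_∈ M)
          → (∀ {x y z} → x ∈ w ∷ M → y ∈ M → z ∈ M → w + x ≢ y + z)
          → Sidon (_∈ w ∷ M)
  sidon-∷ {w} {M} sidon fresh = go
    where
    from-w : ∀ {a' b b'} → a' ∈ w ∷ M → b ∈ w ∷ M → b' ∈ w ∷ M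
           → w + a' ≡ b + b' → SamePair w a' b b'
    from-w _ (here refl) _ e = inj₁ (refl , ∙-cancelˡ w _ _ e)
    from-w {b = b} _ (there _) (here refl) e = inj₂ (refl , ∙-cancelˡ w _ _ (trans e (+-comm b w)))
    from-w a'∈ (there b∈) (there b'∈) e = ⊥-elim (fresh a'∈ b∈ b'∈ e)

    go : Sidon (_∈ w ∷ M)
    go (here refl) a'∈ b∈ b'∈ e = from-w a'∈ b∈ b'∈ e
    go {a} (there a∈) (here refl) b∈ b'∈ e =
      samePair-swap (from-w (there a∈) b∈ b'∈ (trans (+-comm w a) e))
    go (there a∈) (there a'∈) (here refl) b'∈ e = ⊥-elim (fresh b'∈ a∈ a'∈ (sym e))
    go {b = b} (there a∈) (there a'∈) (there b∈) (here refl) e =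
      ⊥-elim (fresh (there b∈) a∈ a'∈ (trans (+-comm w b) (sym e)))
    go (there a∈) (there a'∈) (there b∈) (there b'∈) e = sidon a∈ a'∈ b∈ b'∈ e

  a+b-a≡b : ∀ a b → a + b - a ≡ b
  a+b-a≡b = solve-∀

  a+[n-a]≡n : ∀ n a → a + (n - a) ≡ n
  a+[n-a]≡n = solve-∀

  n-[n-a]≡a : ∀ n a → n - (n - a) ≡ a
  n-[n-a]≡a = solve-∀

  Represents : List ℤ → ℤ → Set
  Represents L n = Any (λ a → n - a ∈ L) L

  represents? : ∀ L n → Dec (Represents L n)
  represents? L n = any? (λ a → n - a ∈? L) L

  represents-sum : ∀ {L a b} → a ∈ L → b ∈ L → Represents L (a + b)
  represents-sum {L} {a} {b} a∈ b∈ = lose a∈ (subst (_∈ L) (sym (a+b-a≡b a b)) b∈)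

  represents-∷ : ∀ {L n x} → Represents L n → Represents (x ∷ L) n
  represents-∷ = there ∘ Any.map there

  represents-bound : ∀ {L n d} → All (λ x → ∣ x ∣ ℕ.≤ d) L → Represents L n → ∣ n ∣ ℕ.≤ d ℕ.+ d
  represents-bound {n = n} {d} bounded rep with find rep
  ... | a , a∈ , n-a∈ = begin
    ∣ n ∣               ≡⟨ cong ∣_∣ (sym (a+[n-a]≡n n a)) ⟩
    ∣ a + (n - a) ∣     ≤⟨ ∣i+j∣≤∣i∣+∣j∣ a (n - a) ⟩
    ∣ a ∣ ℕ.+ ∣ n - a ∣ ≤⟨ ℕ.+-mono-≤ (All.lookup bounded a∈) (All.lookup bounded n-a∈) ⟩
    d ℕ.+ d             ∎
    where open ℕ.≤-Reasoning

  abs-bounds : ∀ {i n} → ∣ i ∣ ℕ.≤ n → - + n ≤ i × i ≤ + n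
  abs-bounds {+ _} m≤n = neg-≤-pos , +≤+ m≤n
  abs-bounds { -[1+ _ ]} (ℕ.s≤s m≤n) = -≤- m≤n , -≤+

  sidon-extend : ∀ {L u v} d → All (λ x → ∣ x ∣ ℕ.≤ d) L → Sidon (_∈ L)
               → + (3 ℕ.* d) < u → v < - + (3 ℕ.* d) → ¬ Represents L (u + v)
               → Sidon (_∈ u ∷ v ∷ L)
  sidon-extend {L} {u} {v} d bounded sidon 3d<u v<-3d unrepresented =
    sidon-∷ (sidon-∷ sidon v-fresh) u-fresh
    where
    D : ℤ
    D = + d

    3d≡3*D : + (3 ℕ.* d) ≡ + 3 * D
    3d≡3*D = pos-* 3 d

    -D≤ : ∀ {x} → x ∈ L → - D ≤ x
    -D≤ = proj₁ ∘ abs-bounds ∘ All.lookup bounded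

    ≤D : ∀ {x} → x ∈ L → x ≤ D
    ≤D = proj₂ ∘ abs-bounds ∘ All.lookup bounded

    -D≤-u∷L : ∀ {x} → x ∈ u ∷ L → - D ≤ x
    -D≤-u∷L (here refl) = <⇒≤ (≤-<-trans neg-≤-pos 3d<u)
    -D≤-u∷L (there x∈) = -D≤ x∈

    ≤D-v∷L : ∀ {x} → x ∈ v ∷ L → x ≤ D
    ≤D-v∷L (here refl) = <⇒≤ (<-≤-trans v<-3d neg-≤-pos)
    ≤D-v∷L (there x∈) = ≤D x∈

    -[3i]+i≡-i+-i : ∀ i → - (+ 3 * i) + i ≡ - i + - i
    -[3i]+i≡-i+-i = solve-∀

    i+i≡3i+-i : ∀ i → i + i ≡ + 3 * i + - i
    i+i≡3i+-i = solve-∀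

    u∉v∷L : ¬ u ∈ v ∷ L
    u∉v∷L u∈ = <⇒≱ (≤-<-trans (+≤+ (ℕ.m≤n*m d 3)) 3d<u) (≤D-v∷L u∈)

    v-fresh : ∀ {x y z} → x ∈ v ∷ L → y ∈ L → z ∈ L → v + x ≢ y + z
    v-fresh {x} {y} {z} x∈ y∈ z∈ = <⇒≢ (begin-strict
      v + x               <⟨ +-mono-<-≤ v<-3d (≤D-v∷L x∈) ⟩
      - + (3 ℕ.* d) + D   ≡⟨ cong (λ t → - t + D) 3d≡3*D ⟩
      - (+ 3 * D) + D     ≡⟨ -[3i]+i≡-i+-i D ⟩
      - D + - D           ≤⟨ +-mono-≤ (-D≤ y∈) (-D≤ z∈) ⟩
      y + z               ∎)
      where open ≤-Reasoning

    u-above : ∀ {x y z} → - D ≤ x → y ≤ D → z ≤ D → y + z < u + x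
    u-above {x} {y} {z} -D≤x y≤D z≤D = begin-strict
      y + z               ≤⟨ +-mono-≤ y≤D z≤D ⟩
      D + D               ≡⟨ i+i≡3i+-i D ⟩
      + 3 * D + - D       ≡⟨ cong (_+ - D) (sym 3d≡3*D) ⟩
      + (3 ℕ.* d) + - D   <⟨ +-mono-<-≤ 3d<u -D≤x ⟩
      u + x               ∎
      where open ≤-Reasoning

    u-fresh : ∀ {x y z} → x ∈ u ∷ v ∷ L → y ∈ v ∷ L → z ∈ v ∷ L → u + x ≢ y + z
    u-fresh (there (here refl)) (here refl) z∈ e =
      u∉v∷L (subst (_∈ v ∷ L) (sym (∙-cancelʳ v u _ (trans e (+-comm v _)))) z∈)
    u-fresh (there (here refl)) y∈ (here refl) e =
      u∉v∷L (subst (_∈ v ∷ L) (sym (∙-cancelʳ v u _ e)) y∈)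
    u-fresh (there (here refl)) (there y∈) (there z∈) e =
      unrepresented (subst (Represents L) (sym e) (represents-sum y∈ z∈))
    u-fresh (here refl) y∈ z∈ =
      ≢-sym (<⇒≢ (u-above (-D≤-u∷L (here refl)) (≤D-v∷L y∈) (≤D-v∷L z∈)))
    u-fresh (there (there x∈)) y∈ z∈ =
      ≢-sym (<⇒≢ (u-above (-D≤ x∈) (≤D-v∷L y∈) (≤D-v∷L z∈)))

  repPair-unique : ∀ {A n b c} → Sidon (T ∘ A) → RepPair A n b → RepPair A n c → c ≡ b
  repPair-unique {n = n} {b} {c} sidon (b∈ , n-b∈ , b≤n-b) (c∈ , n-c∈ , c≤n-c)
    with sidon c∈ n-c∈ b∈ n-b∈ (trans (a+[n-a]≡n n c) (sym (a+[n-a]≡n n b)))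
  ... | inj₁ (c≡b , _) = c≡b
  ... | inj₂ (c≡n-b , n-c≡b) =
    ≤-antisym (≤-trans c≤n-c (≤-reflexive n-c≡b)) (≤-trans b≤n-b (≤-reflexive (sym c≡n-b)))

  repPair-of-sum : ∀ {A n a} → T (A a) → T (A (n - a)) → ∃ (RepPair A n)
  repPair-of-sum {A} {n} {a} a∈ n-a∈ with a ≤? n - a
  ... | yes a≤n-a = a , a∈ , n-a∈ , a≤n-a
  ... | no  a≰n-a = n - a , n-a∈ , subst (T ∘ A) (sym (n-[n-a]≡a n a)) a∈
                          , subst (n - a ≤_) (sym (n-[n-a]≡a n a)) (<⇒≤ (≰⇒> a≰n-a))

  repOne-of-sidon : ∀ {A n a} → Sidon (T ∘ A) → T (A a) → T (A (n - a)) → RepOne A n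
  repOne-of-sidon {n = n} sidon a∈ n-a∈ with repPair-of-sum {n = n} a∈ n-a∈
  ... | b , pair = b , pair , λ _ → repPair-unique {n = n} sidon pair

open SidonSets

open import Data.Nat
  using (ℕ; zero; suc; _≤_; _<_; _+_; _*_; _∸_; _^_; _⊔_; _≤?_; _<?_; _≤′_; ≤′-refl; ≤′-step; z≤n; s≤s)
open import Data.Nat.Properties
open import Data.Nat.Tactic.RingSolver using (solve-∀)

T-does : ∀ {P : Set} (p? : Dec P) → T (does p?) ⇔ P
T-does (yes p) = mk⇔ (λ _ → p) (λ _ → _)
T-does (no ¬p) = mk⇔ (λ ()) ¬p

countWithin : ℕ → List ℤ → ℕ
countWithin N L = length (filter (λ x → ∣ x ∣ ≤? N) L)

length-filter-∷ : ∀ {P : ℤ → Set} (P? : ∀ x → Dec (P x)) x xs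
                → length (filter P? (x ∷ xs)) ≡ [ does (P? x) ] + length (filter P? xs)
length-filter-∷ P? x xs with does (P? x)
... | true  = refl
... | false = refl

distinct-from-larger : ∀ {L d y} → All (λ x → ∣ x ∣ ≤ d) L → d < ∣ y ∣ → All (y ≢_) L
distinct-from-larger bounded d<y =
  All.map (λ x≤d y≡x → <⇒≱ d<y (subst (λ t → ∣ t ∣ ≤ _) (sym y≡x) x≤d)) bounded

-- An enumeration of ℤ

next : ℤ → ℤ
next (+ m)    = -[1+ m ]
next -[1+ m ] = + suc m

enum : ℕ → ℤ
enum zero    = + 0
enum (suc k) = next (enum k)

∣enum∣≤ : ∀ k → ∣ enum k ∣ ≤ k
∣enum∣≤ zero    = z≤n
∣enum∣≤ (suc k) = ≤-trans (∣next∣≤ (enum k)) (s≤s (∣enum∣≤ k))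
  where
  ∣next∣≤ : ∀ z → ∣ next z ∣ ≤ suc ∣ z ∣
  ∣next∣≤ (+ m)    = ≤-refl
  ∣next∣≤ -[1+ m ] = n≤1+n (suc m)

enum-double : ∀ m → enum (m + m) ≡ + m
enum-double zero    = refl
enum-double (suc m) rewrite +-suc m m = cong (next ∘ next) (enum-double m)

enum-surjective : ∀ z → ∃ λ k → enum k ≡ z
enum-surjective (+ m)    = m + m , enum-double m
enum-surjective -[1+ m ] = suc (m + m) , cong next (enum-double m)

-- One step of the construction

upper lower : ℕ → ℤ → ℤ
upper d (+ m)    = + (suc (3 * d) + m)
upper d -[1+ m ] = + suc (3 * d)
lower d (+ m)    = -[1+ 3 * d ]
lower d -[1+ m ] = -[1+ 3 * d + suc m ]

upper+lower≡ : ∀ d n → upper d n ℤ.+ lower d n ≡ n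
upper+lower≡ d (+ m) =
  trans (cong (ℤ._+ ℤ.- + suc (3 * d)) (ℤ.pos-+ (suc (3 * d)) m)) (a+b-a≡b (+ suc (3 * d)) (+ m))
upper+lower≡ d -[1+ m ] =
  trans (cong (λ t → + suc (3 * d) ℤ.+ ℤ.- t) (ℤ.pos-+ (suc (3 * d)) (suc m)))
        (a-[a+b]≡-b (+ suc (3 * d)) (+ suc m))
  where
  a-[a+b]≡-b : ∀ a b → a ℤ.- (a ℤ.+ b) ≡ ℤ.- b
  a-[a+b]≡-b = ℤ-Solver.solve-∀

3d<upper : ∀ d n → + (3 * d) ℤ.< upper d n
3d<upper d (+ m)    = ℤ.+<+ (s≤s (m≤m+n (3 * d) m))
3d<upper d -[1+ m ] = ℤ.+<+ ≤-refl

lower<-3d : ∀ d n → lower d n ℤ.< ℤ.- + (3 * d)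
lower<-3d d (+ m)    = ℤ.neg-mono-< (ℤ.+<+ ≤-refl)
lower<-3d d -[1+ m ] = ℤ.neg-mono-< (ℤ.+<+ (s≤s (m≤m+n (3 * d) (suc m))))

upper≢lower : ∀ d n → upper d n ≢ lower d n
upper≢lower d (+ m)    ()
upper≢lower d -[1+ m ] ()

upper-size : ∀ d n → suc (3 * d) ≤ ∣ upper d n ∣ × ∣ upper d n ∣ ≤ suc (3 * d) + ∣ n ∣
upper-size d (+ m)    = m≤m+n (suc (3 * d)) m , ≤-refl
upper-size d -[1+ m ] = ≤-refl , m≤m+n (suc (3 * d)) (suc m)

lower-size : ∀ d n → suc (3 * d) ≤ ∣ lower d n ∣ × ∣ lower d n ∣ ≤ suc (3 * d) + ∣ n ∣
lower-size d (+ m)    = ≤-refl , m≤m+n (suc (3 * d)) m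
lower-size d -[1+ m ] = m≤m+n (suc (3 * d)) (suc m) , ≤-refl

new-pair-count : ∀ d n N → N < suc (3 * d) + ∣ n ∣
               → [ does (∣ upper d n ∣ ≤? N) ] + [ does (∣ lower d n ∣ ≤? N) ]
                 ≡ [ does (3 * d <? N) ]
new-pair-count d (+ m) N N<d' =
  cong (λ b → [ b ] + [ does (3 * d <? N) ]) (dec-false (suc (3 * d) + m ≤? N) (<⇒≱ N<d'))
new-pair-count d -[1+ m ] N N<d' =
  trans (cong (λ b → [ does (3 * d <? N) ] + [ b ])
              (dec-false (suc (3 * d) + suc m ≤? N) (<⇒≱ N<d')))
        (+-identityʳ _)

target : List ℤ → ℕ → ℤ → ℤ
target L d m with represents? L m
... | yes _ = + suc (d + d)
... | no _  = m

target-unrepresented : ∀ {L d} m → All (λ x → ∣ x ∣ ≤ d) L → ¬ Represents L (target L d m)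
target-unrepresented {L} {d} m bounded with represents? L m
... | yes _   = 1+n≰n ∘ represents-bound {n = + suc (d + d)} bounded
... | no ¬rep = ¬rep

target-covers : ∀ L d m → Represents L m ⊎ target L d m ≡ m
target-covers L d m with represents? L m
... | yes rep = inj₁ rep
... | no _    = inj₂ refl

target-size : ∀ L d {m} → ∣ m ∣ ≤ suc (d + d) → ∣ target L d m ∣ ≤ suc (d + d)
target-size L d {m} m≤ with represents? L m
... | yes _ = ≤-refl
... | no _  = m≤

record Stage : Set where
  constructor ⟨_,_⟩
  field
    elems  : List ℤ
    radius : ℕ
open Stage

Bounded : Stage → Set
Bounded s = All (λ x → ∣ x ∣ ≤ radius s) (elems s)

extend : ℤ → Stage → Stage
extend m ⟨ L , d ⟩ = ⟨ upper d n ∷ lower d n ∷ L , suc (3 * d) + ∣ n ∣ ⟩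
  where
  n : ℤ
  n = target L d m

module Extension (m : ℤ) (s : Stage) where

  open Stage s renaming (elems to L; radius to d)

  n u v : ℤ
  n = target L d m
  u = upper d n
  v = lower d n

  radius-triples : 3 * d < radius (extend m s)
  radius-triples = s≤s (m≤m+n (3 * d) ∣ n ∣)

  radius-grows : d < radius (extend m s)
  radius-grows = ≤-<-trans (m≤n*m d 3) radius-triples

  radius-quintuples : ∣ m ∣ ≤ suc (d + d) → 2 * radius (extend m s) + 1 ≤ 5 * (2 * d + 1)
  radius-quintuples m≤ = begin
    2 * (suc (3 * d) + ∣ n ∣) + 1
      ≤⟨ +-monoˡ-≤ 1 (*-monoʳ-≤ 2 (+-monoʳ-≤ (suc (3 * d)) (target-size L d m≤))) ⟩
    2 * (suc (3 * d) + suc (d + d)) + 1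
      ≡⟨ 2[1+3d+1+2d]+1≡5[2d+1] d ⟩
    5 * (2 * d + 1) ∎
    where
    open ≤-Reasoning
    2[1+3d+1+2d]+1≡5[2d+1] : ∀ d → 2 * (suc (3 * d) + suc (d + d)) + 1 ≡ 5 * (2 * d + 1)
    2[1+3d+1+2d]+1≡5[2d+1] = solve-∀

  d<∣u∣ : d < ∣ u ∣
  d<∣u∣ = ≤-trans (s≤s (m≤n*m d 3)) (proj₁ (upper-size d n))

  d<∣v∣ : d < ∣ v ∣
  d<∣v∣ = ≤-trans (s≤s (m≤n*m d 3)) (proj₁ (lower-size d n))

  bounded : Bounded s → Bounded (extend m s)
  bounded b = proj₂ (upper-size d n) ∷ proj₂ (lower-size d n)
            ∷ All.map (λ x≤d → ≤-trans x≤d (<⇒≤ radius-grows)) b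

  sidon : Bounded s → Sidon (_∈ L) → Sidon (_∈ elems (extend m s))
  sidon b sidonL = sidon-extend d b sidonL (3d<upper d n) (lower<-3d d n)
    (subst (¬_ ∘ Represents L) (sym (upper+lower≡ d n)) (target-unrepresented m b))

  unique : Bounded s → Unique L → Unique (elems (extend m s))
  unique b uniqueL =
    (upper≢lower d n ∷ distinct-from-larger b d<∣u∣) ∷ distinct-from-larger b d<∣v∣ ∷ uniqueL

  new-or-large : ∀ {x} → x ∈ elems (extend m s) → x ∈ L ⊎ d < ∣ x ∣
  new-or-large (here refl)         = inj₂ d<∣u∣
  new-or-large (there (here refl)) = inj₂ d<∣v∣
  new-or-large (there (there x∈))  = inj₁ x∈

  represents-m : Represents (elems (extend m s)) m
  represents-m with target-covers L d m
  ... | inj₁ rep = represents-∷ {n = m} (represents-∷ {n = m} rep)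
  ... | inj₂ n≡m = subst (Represents (elems (extend m s))) (trans (upper+lower≡ d n) n≡m)
                         (represents-sum (here refl) (there (here refl)))

  count-within : ∀ {N} → Bounded s → d ≤ N → N < radius (extend m s)
               → countWithin N (elems (extend m s)) ≡ [ does (3 * d <? N) ] + length L
  count-within {N} b d≤N N<d' = begin
    length (filter P? (u ∷ v ∷ L))
      ≡⟨ length-filter-∷ P? u (v ∷ L) ⟩
    [ does (P? u) ] + length (filter P? (v ∷ L))
      ≡⟨ cong (_+_ [ does (P? u) ]) (length-filter-∷ P? v L) ⟩
    [ does (P? u) ] + ([ does (P? v) ] + length (filter P? L))
      ≡⟨ sym (+-assoc [ does (P? u) ] _ _) ⟩
    [ does (P? u) ] + [ does (P? v) ] + length (filter P? L)
      ≡⟨ cong₂ _+_ (new-pair-count d n N N<d') (cong length (filter-all P? L-within)) ⟩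
    [ does (3 * d <? N) ] + length L ∎
    where
    open ≡-Reasoning
    P? : ∀ x → Dec (∣ x ∣ ≤ N)
    P? x = ∣ x ∣ ≤? N
    L-within : All (λ x → ∣ x ∣ ≤ N) L
    L-within = All.map (λ x≤d → ≤-trans x≤d d≤N) b

-- Starting from {0} instead, the lower bound would fail at N = 6; this start satisfies both
-- bounds for 1 ≤ N < 9.
S₀ : List ℤ
S₀ = + 0 ∷ + 1 ∷ -[1+ 1 ] ∷ + 6 ∷ -[1+ 8 ] ∷ []

stage : ℕ → Stage
stage zero    = ⟨ S₀ , 9 ⟩
stage (suc k) = extend (enum k) (stage k)

module Step (k : ℕ) = Extension (enum k) (stage k)

bounded : ∀ k → Bounded (stage k)
bounded zero    = from-yes (all? (λ x → ∣ x ∣ ≤? 9) S₀)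
bounded (suc k) = Step.bounded k (bounded k)

sidon : ∀ k → Sidon (_∈ elems (stage k))
sidon zero    = from-yes (sidon? S₀)
sidon (suc k) = Step.sidon k (bounded k) (sidon k)

unique : ∀ k → Unique (elems (stage k))
unique zero    = from-yes (unique? S₀)
unique (suc k) = Step.unique k (bounded k) (unique k)

length-elems : ∀ k → length (elems (stage k)) ≡ 5 + (k + k)
length-elems zero    = refl
length-elems (suc k) = trans (cong (_+_ 2) (length-elems k)) (cong (_+_ 6) (sym (+-suc k k)))

k<radius : ∀ k → k < radius (stage k)
k<radius zero    = s≤s z≤n
k<radius (suc k) = ≤-<-trans (k<radius k) (Step.radius-grows k)

radius-mono : ∀ {k j} → k ≤′ j → radius (stage k) ≤ radius (stage j)
radius-mono ≤′-refl            = ≤-refl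
radius-mono (≤′-step {j} k≤′j) = ≤-trans (radius-mono k≤′j) (<⇒≤ (Step.radius-grows j))

radius-lower-bound : ∀ k → 3 ^ (2 + k) ≤ radius (stage k)
radius-lower-bound zero    = ≤-refl
radius-lower-bound (suc k) = ≤-trans (*-monoʳ-≤ 3 (radius-lower-bound k)) (<⇒≤ (Step.radius-triples k))

radius-upper-bound : ∀ k → 2 * radius (stage k) + 1 ≤ 19 * 5 ^ k
radius-upper-bound zero    = ≤-refl
radius-upper-bound (suc k) = begin
  2 * radius (stage (suc k)) + 1 ≤⟨ Step.radius-quintuples k ∣enum∣≤2r+1 ⟩
  5 * (2 * r + 1)                ≤⟨ *-monoʳ-≤ 5 (radius-upper-bound k) ⟩
  5 * (19 * 5 ^ k)               ≡⟨ 5[19x]≡19[5x] (5 ^ k) ⟩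
  19 * 5 ^ suc k                 ∎
  where
  open ≤-Reasoning
  r : ℕ
  r = radius (stage k)
  ∣enum∣≤2r+1 : ∣ enum k ∣ ≤ suc (r + r)
  ∣enum∣≤2r+1 = ≤-trans (∣enum∣≤ k) (≤-trans (<⇒≤ (k<radius k)) (≤-trans (m≤m+n r r) (n≤1+n _)))
  5[19x]≡19[5x] : ∀ x → 5 * (19 * x) ≡ 19 * (5 * x)
  5[19x]≡19[5x] = solve-∀

elems-⊆ : ∀ {k j x} → k ≤′ j → x ∈ elems (stage k) → x ∈ elems (stage j)
elems-⊆ ≤′-refl        = id
elems-⊆ (≤′-step k≤′j) = there ∘ there ∘ elems-⊆ k≤′j

elems-stable : ∀ {k j x} → k ≤′ j → ∣ x ∣ ≤ radius (stage k) → x ∈ elems (stage j) → x ∈ elems (stage k)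
elems-stable ≤′-refl _ = id
elems-stable (≤′-step {j} k≤′j) x≤r x∈ with Step.new-or-large j x∈
... | inj₁ x∈old = elems-stable k≤′j x≤r x∈old
... | inj₂ r<x   = ⊥-elim (<⇒≱ r<x (≤-trans x≤r (radius-mono k≤′j)))

∈-transfer : ∀ k {j x} → ∣ x ∣ ≤ radius (stage k) → x ∈ elems (stage j) → x ∈ elems (stage k)
∈-transfer k {j} x≤r x∈ with ≤-total k j
... | inj₁ k≤j = elems-stable (≤⇒≤′ k≤j) x≤r x∈
... | inj₂ j≤k = elems-⊆ (≤⇒≤′ j≤k) x∈

-- The limit set

-- Stage ∣ z ∣ has radius above ∣ z ∣, and later stages only add elements of larger absolute value.
A : IntSet
A z = does (z ∈? elems (stage ∣ z ∣))

A-agrees : ∀ k {x} → ∣ x ∣ ≤ radius (stage k) → A x ≡ does (x ∈? elems (stage k))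
A-agrees k {x} x≤r =
  does-⇔ (mk⇔ (∈-transfer k {∣ x ∣} x≤r) (∈-transfer ∣ x ∣ {k} (<⇒≤ (k<radius ∣ x ∣))))
         (x ∈? elems (stage ∣ x ∣)) (x ∈? elems (stage k))

∈A⇔∈stage : ∀ k {x} → ∣ x ∣ ≤ radius (stage k) → T (A x) ⇔ x ∈ elems (stage k)
∈A⇔∈stage k {x} x≤r =
  subst (λ b → T b ⇔ x ∈ elems (stage k)) (sym (A-agrees k x≤r)) (T-does (x ∈? elems (stage k)))

A-sidon : Sidon (T ∘ A)
A-sidon {a} {a'} {b} {b'} a∈ a'∈ b∈ b'∈ =
  sidon K (lift (≤-trans (m≤m⊔n ∣ a ∣ ∣ a' ∣) (m≤m⊔n K₁ K₂)) a∈)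
          (lift (≤-trans (m≤n⊔m ∣ a ∣ ∣ a' ∣) (m≤m⊔n K₁ K₂)) a'∈)
          (lift (≤-trans (m≤m⊔n ∣ b ∣ ∣ b' ∣) (m≤n⊔m K₁ K₂)) b∈)
          (lift (≤-trans (m≤n⊔m ∣ b ∣ ∣ b' ∣) (m≤n⊔m K₁ K₂)) b'∈)
  where
  K₁ K₂ K : ℕ
  K₁ = ∣ a ∣ ⊔ ∣ a' ∣
  K₂ = ∣ b ∣ ⊔ ∣ b' ∣
  K  = K₁ ⊔ K₂
  lift : ∀ {x} → ∣ x ∣ ≤ K → T (A x) → x ∈ elems (stage K)
  lift x≤K = Equivalence.to (∈A⇔∈stage K (≤-trans x≤K (<⇒≤ (k<radius K))))

A-repOne : ∀ n → RepOne A n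
A-repOne n with enum-surjective n
... | k , refl with find (Step.represents-m k)
...   | a , a∈ , n-a∈ = repOne-of-sidon {n = enum k} A-sidon (from-stage a∈) (from-stage n-a∈)
  where
  from-stage : ∀ {x} → x ∈ elems (stage (suc k)) → T (A x)
  from-stage x∈ = Equivalence.from (∈A⇔∈stage (suc k) (All.lookup (bounded (suc k)) x∈)) x∈

-- Counting A(-N, N)

countSym-cong : ∀ {f g} N → (∀ {z} → ∣ z ∣ ≤ N → f z ≡ g z) → countSym f N ≡ countSym g N
countSym-cong zero    f≗g = cong [_] (f≗g z≤n)
countSym-cong (suc N) f≗g =
  cong₂ _+_ (cong₂ _+_ (countSym-cong N (f≗g ∘ m≤n⇒m≤1+n)) (cong [_] (f≗g ≤-refl)))
            (cong [_] (f≗g ≤-refl))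

countSym-false : ∀ N → countSym (λ _ → false) N ≡ 0
countSym-false zero    = refl
countSym-false (suc N) = cong (_+ 0) (cong (_+ 0) (countSym-false N))

[∨]-disjoint : ∀ {b c} → (T b → ¬ T c) → [ b ∨ c ] ≡ [ b ] + [ c ]
[∨]-disjoint {true} {true} disjoint = ⊥-elim (disjoint _ _)
[∨]-disjoint {true} {false} _       = refl
[∨]-disjoint {false} _              = refl

countSym-∨ : ∀ {f g} N → (∀ z → T (f z) → ¬ T (g z))
           → countSym (λ z → f z ∨ g z) N ≡ countSym f N + countSym g N
countSym-∨ zero disjoint = [∨]-disjoint (disjoint (+ 0))
countSym-∨ {f} {g} (suc N) disjoint
  rewrite countSym-∨ N disjoint | [∨]-disjoint (disjoint (+ suc N)) | [∨]-disjoint (disjoint -[1+ N ]) =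
  interchange (countSym f N) (countSym g N) [ f (+ suc N) ] [ g (+ suc N) ] [ f -[1+ N ] ] [ g -[1+ N ] ]
  where
  interchange : ∀ a b c d e h → a + b + (c + d) + (e + h) ≡ a + c + e + (b + d + h)
  interchange = solve-∀

[≤?]-step : ∀ a N → [ does (a ≤? N) ] + [ does (suc N ≟ a) ] ≡ [ does (a ≤? suc N) ]
[≤?]-step a N with <-cmp a (suc N)
... | tri< a<1+N _ _
  rewrite dec-true (a ≤? N) (≤-pred a<1+N) | dec-false (suc N ≟ a) (>⇒≢ a<1+N)
        | dec-true (a ≤? suc N) (<⇒≤ a<1+N) = refl
... | tri≈ _ refl _
  rewrite dec-false (suc N ≤? N) 1+n≰n | dec-true (suc N ≟ suc N) refl
        | dec-true (suc N ≤? suc N) ≤-refl = refl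
... | tri> _ _ 1+N<a
  rewrite dec-false (a ≤? N) (<⇒≱ (<-trans (n<1+n N) 1+N<a)) | dec-false (suc N ≟ a) (<⇒≢ 1+N<a)
        | dec-false (a ≤? suc N) (<⇒≱ 1+N<a) = refl

countSym-≟ : ∀ x N → countSym (λ z → does (z ℤ.≟ x)) N ≡ [ does (∣ x ∣ ≤? N) ]
countSym-≟ (+ zero)   zero = refl
countSym-≟ (+ suc m)  zero = refl
countSym-≟ -[1+ m ]   zero = refl
countSym-≟ (+ m) (suc N) rewrite countSym-≟ (+ m) N = trans (+-identityʳ _) ([≤?]-step m N)
countSym-≟ -[1+ m ] (suc N) rewrite countSym-≟ -[1+ m ] N =
  trans (cong (_+ [ does (N ≟ m) ]) (+-identityʳ [ does (suc m ≤? N) ])) ([≤?]-step (suc m) N)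

countSym-∈ : ∀ {L} N → Unique L → countSym (λ z → does (z ∈? L)) N ≡ countWithin N L
countSym-∈ N [] = countSym-false N
countSym-∈ {x ∷ L} N (x∉L ∷ uniqueL) = begin
  countSym (λ z → does (z ℤ.≟ x) ∨ does (z ∈? L)) N
    ≡⟨ countSym-∨ N disjoint ⟩
  countSym (λ z → does (z ℤ.≟ x)) N + countSym (λ z → does (z ∈? L)) N
    ≡⟨ cong₂ _+_ (countSym-≟ x N) (countSym-∈ N uniqueL) ⟩
  [ does (∣ x ∣ ≤? N) ] + countWithin N L
    ≡⟨ sym (length-filter-∷ (λ x → ∣ x ∣ ≤? N) x L) ⟩
  countWithin N (x ∷ L) ∎
  where
  open ≡-Reasoning
  disjoint : ∀ z → T (does (z ℤ.≟ x)) → ¬ T (does (z ∈? L))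
  disjoint z z≟x z∈?L = All.lookup x∉L (subst (_∈ L) z≡x z∈L) refl
    where
    z≡x : z ≡ x
    z≡x = Equivalence.to (T-does (z ℤ.≟ x)) z≟x
    z∈L : z ∈ L
    z∈L = Equivalence.to (T-does (z ∈? L)) z∈?L

countSym-A : ∀ k {N} → N ≤ radius (stage k) → countSym A N ≡ countWithin N (elems (stage k))
countSym-A k {N} N≤r =
  trans (countSym-cong N (λ z≤N → A-agrees k (≤-trans z≤N N≤r))) (countSym-∈ N (unique k))

-- The numerical bounds

-- The theorem's inequalities, exponentiated, for all real x ∈ [N, N + 1), on which A(-x, x) = c.
Bounds : ℕ → ℕ → Set
Bounds N c = (25 * (N + 1) ^ 2 ≤ 9 * 5 ^ c) × (3 ^ (c ∸ 2) ≤ N ^ 2)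

bounds? : ∀ N c → Dec (Bounds N c)
bounds? N c = (25 * (N + 1) ^ 2 ≤? 9 * 5 ^ c) ×-dec (3 ^ (c ∸ 2) ≤? N ^ 2)

lower-bound : ∀ N a j e {c} → 2 * (N + 1) ≤ a * 5 ^ j → 25 * (a * a) ≤ 36 * 5 ^ e → e + (j + j) ≤ c
            → 25 * (N + 1) ^ 2 ≤ 9 * 5 ^ c
lower-bound N a j e {c} 2[N+1]≤a5ʲ 25a²≤36·5ᵉ exponent≤ = *-cancelˡ-≤ 4 (begin
  4 * (25 * (N + 1) ^ 2)               ≡⟨ 4[25x²]≡25[2x]² (N + 1) ⟩
  25 * (2 * (N + 1)) ^ 2               ≤⟨ *-monoʳ-≤ 25 (^-monoˡ-≤ 2 2[N+1]≤a5ʲ) ⟩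
  25 * (a * 5 ^ j) ^ 2                 ≡⟨ 25[ay]²≡25a²·y² a (5 ^ j) ⟩
  25 * (a * a) * (5 ^ j * 5 ^ j)       ≤⟨ *-monoˡ-≤ (5 ^ j * 5 ^ j) 25a²≤36·5ᵉ ⟩
  36 * 5 ^ e * (5 ^ j * 5 ^ j)         ≡⟨ 36x·y≡4[9[xy]] (5 ^ e) (5 ^ j * 5 ^ j) ⟩
  4 * (9 * (5 ^ e * (5 ^ j * 5 ^ j)))  ≡⟨ cong (λ t → 4 * (9 * t)) (sym 5^[e+2j]) ⟩
  4 * (9 * 5 ^ (e + (j + j)))          ≤⟨ *-monoʳ-≤ 4 (*-monoʳ-≤ 9 (^-monoʳ-≤ 5 exponent≤)) ⟩
  4 * (9 * 5 ^ c)                      ∎)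
  where
  open ≤-Reasoning
  5^[e+2j] : 5 ^ (e + (j + j)) ≡ 5 ^ e * (5 ^ j * 5 ^ j)
  5^[e+2j] = trans (^-distribˡ-+-* 5 e (j + j)) (cong (5 ^ e *_) (^-distribˡ-+-* 5 j j))
  4[25x²]≡25[2x]² : ∀ x → 4 * (25 * (x * (x * 1))) ≡ 25 * ((2 * x) * ((2 * x) * 1))
  4[25x²]≡25[2x]² = solve-∀
  25[ay]²≡25a²·y² : ∀ a y → 25 * ((a * y) * ((a * y) * 1)) ≡ 25 * (a * a) * (y * y)
  25[ay]²≡25a²·y² = solve-∀
  36x·y≡4[9[xy]] : ∀ x y → 36 * x * y ≡ 4 * (9 * (x * y))
  36x·y≡4[9[xy]] = solve-∀

upper-bound : ∀ {N j i} → 3 ^ j ≤ N → i ≤ j + j → 3 ^ i ≤ N ^ 2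
upper-bound {N} {j} {i} 3ʲ≤N i≤2j = begin
  3 ^ i          ≤⟨ ^-monoʳ-≤ 3 i≤2j ⟩
  3 ^ (j + j)    ≡⟨ ^-distribˡ-+-* 3 j j ⟩
  3 ^ j * 3 ^ j  ≤⟨ *-mono-≤ 3ʲ≤N 3ʲ≤N ⟩
  N * N          ≡⟨ cong (N *_) (sym (*-identityʳ N)) ⟩
  N ^ 2          ∎
  where open ≤-Reasoning

bounds-before-gap : ∀ k {N} → radius (stage k) ≤ N → N ≤ 3 * radius (stage k) → Bounds N (5 + (k + k))
bounds-before-gap k {N} r≤N N≤3r =
  lower-bound N 57 k 5 2[N+1]≤57·5ᵏ (from-yes (25 * (57 * 57) ≤? 36 * 5 ^ 5)) ≤-refl ,
  upper-bound {j = 2 + k} (≤-trans (radius-lower-bound k) r≤N)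
              (≤-trans (n≤1+n _) (≤-reflexive (4+2k≡[2+k]+[2+k] k)))
  where
  r : ℕ
  r = radius (stage k)
  1+2[3r+1]≡3[2r+1] : ∀ r → suc (2 * (3 * r + 1)) ≡ 3 * (2 * r + 1)
  1+2[3r+1]≡3[2r+1] = solve-∀
  2[N+1]≤57·5ᵏ : 2 * (N + 1) ≤ 57 * 5 ^ k
  2[N+1]≤57·5ᵏ = begin
    2 * (N + 1)            ≤⟨ *-monoʳ-≤ 2 (+-monoˡ-≤ 1 N≤3r) ⟩
    2 * (3 * r + 1)        ≤⟨ n≤1+n _ ⟩
    suc (2 * (3 * r + 1))  ≡⟨ 1+2[3r+1]≡3[2r+1] r ⟩
    3 * (2 * r + 1)        ≤⟨ *-monoʳ-≤ 3 (radius-upper-bound k) ⟩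
    3 * (19 * 5 ^ k)       ≡⟨ sym (*-assoc 3 19 (5 ^ k)) ⟩
    57 * 5 ^ k             ∎
    where open ≤-Reasoning
  4+2k≡[2+k]+[2+k] : ∀ k → 4 + (k + k) ≡ (2 + k) + (2 + k)
  4+2k≡[2+k]+[2+k] = solve-∀

bounds-after-gap : ∀ k {N} → 3 * radius (stage k) < N → N < radius (stage (suc k))
                 → Bounds N (6 + (k + k))
bounds-after-gap k {N} 3r<N N<r' =
  lower-bound N 19 (suc k) 4 2[N+1]≤19·5ᵏ⁺¹ (from-yes (25 * (19 * 19) ≤? 36 * 5 ^ 4))
              (≤-reflexive (4+2[1+k]≡6+2k k)) ,
  upper-bound {j = 3 + k} (≤-trans (*-monoʳ-≤ 3 (radius-lower-bound k)) (<⇒≤ 3r<N))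
              (≤-trans (m≤m+n (4 + (k + k)) 2) (≤-reflexive (4+2k+2≡[3+k]+[3+k] k)))
  where
  2[N+1]≤19·5ᵏ⁺¹ : 2 * (N + 1) ≤ 19 * 5 ^ suc k
  2[N+1]≤19·5ᵏ⁺¹ = begin
    2 * (N + 1)                      ≤⟨ *-monoʳ-≤ 2 (≤-trans (≤-reflexive (+-comm N 1)) N<r') ⟩
    2 * radius (stage (suc k))       ≤⟨ m≤m+n _ 1 ⟩
    2 * radius (stage (suc k)) + 1   ≤⟨ radius-upper-bound (suc k) ⟩
    19 * 5 ^ suc k                   ∎
    where open ≤-Reasoning
  4+2[1+k]≡6+2k : ∀ k → 4 + ((1 + k) + (1 + k)) ≡ 6 + (k + k)
  4+2[1+k]≡6+2k = solve-∀
  4+2k+2≡[3+k]+[3+k] : ∀ k → 4 + (k + k) + 2 ≡ (3 + k) + (3 + k)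
  4+2k+2≡[3+k]+[3+k] = solve-∀

bounds-in-bracket : ∀ k {N} → radius (stage k) ≤ N → N < radius (stage (suc k))
                  → Bounds N ([ does (3 * radius (stage k) <? N) ] + (5 + (k + k)))
bounds-in-bracket k {N} r≤N N<r' with 3 * radius (stage k) <? N
... | no N≯3r =
  subst (λ b → Bounds N ([ b ] + (5 + (k + k)))) (sym (dec-false (3 * radius (stage k) <? N) N≯3r))
        (bounds-before-gap k r≤N (≮⇒≥ N≯3r))
... | yes 3r<N =
  subst (λ b → Bounds N ([ b ] + (5 + (k + k)))) (sym (dec-true (3 * radius (stage k) <? N) 3r<N))
        (bounds-after-gap k 3r<N N<r')

bracket : ∀ (f : ℕ → ℕ) {N} j → f 0 ≤ N → N < f j → ∃ λ k → f k ≤ N × N < f (suc k)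
bracket f zero    f0≤N N<f0   = ⊥-elim (<⇒≱ N<f0 f0≤N)
bracket f {N} (suc j) f0≤N N<fj+1 with N <? f j
... | yes N<fj = bracket f j f0≤N N<fj
... | no  N≮fj = j , ≮⇒≥ N≮fj , N<fj+1

bounds-large : ∀ {N} → 9 ≤ N → Bounds N (countSym A N)
bounds-large {N} 9≤N with bracket (radius ∘ stage) N 9≤N (k<radius N)
... | k , r≤N , N<r' = subst (Bounds N) (sym count) (bounds-in-bracket k r≤N N<r')
  where
  r : ℕ
  r = radius (stage k)
  count : countSym A N ≡ [ does (3 * r <? N) ] + (5 + (k + k))
  count = begin
    countSym A N                                      ≡⟨ countSym-A (suc k) (<⇒≤ N<r') ⟩
    countWithin N (elems (stage (suc k)))             ≡⟨ Step.count-within k (bounded k) r≤N N<r' ⟩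
    [ does (3 * r <? N) ] + length (elems (stage k))  ≡⟨ cong (_+_ _) (length-elems k) ⟩
    [ does (3 * r <? N) ] + (5 + (k + k))             ∎
    where open ≡-Reasoning

bounds-small : ∀ {N} → 1 ≤ N → N < 9 → Bounds N (countSym A N)
bounds-small {suc n} _ (s≤s n<8) =
  subst (Bounds (suc n)) (sym (countSym-A 0 (<⇒≤ (s≤s n<8)))) (checked n<8)
  where
  checked : ∀ {n} → n < 8 → Bounds (suc n) (countWithin (suc n) S₀)
  checked = from-yes (allUpTo? (λ n → bounds? (suc n) (countWithin (suc n) S₀)) 8)

theorem2 : Σ IntSet λ A → ((n : ℤ) → RepOne A n)
               × ((N : ℕ) → 1 ≤ N
                   → (25 * (N + 1) ^ 2 ≤ 9 * 5 ^ countSym A N)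
                     × (3 ^ (countSym A N ∸ 2) ≤ N ^ 2))
theorem2 = A , A-repOne , bounds
  where
  bounds : ∀ N → 1 ≤ N → Bounds N (countSym A N)
  bounds N 1≤N with N <? 9
  ... | yes N<9 = bounds-small 1≤N N<9
  ... | no  N≮9 = bounds-large (≮⇒≥ N≮9)
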